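{- Let $f(x)\in\mathbb{Z}[x]$ have degree $d\ge 2$ and let $t\in\mathbb{Z}$. If $A=\{t+n_s\mathbb{Z}\}_{s=1}^k$ (with $n_s$ positive integers) is a minimal $t$-cover of $\operatorname{Orb}_f(t)$, then $k=1$. In particular, if $A=\{t+n_s\mathbb{Z}\}_{s=1}^k$, $k\ge 1$, is a system of arithmetic progressions such that $\delta_{f,t}(t+n_s\mathbb{Z})<1$ for all $s=1,\dots,k$, then $\delta_{f,t}\left(\bigcup_{s=1}^k (t+n_s\mathbb{Z})\right)<1$.
   Context: $\operatorname{Orb}_f(t)=\{f^n(t):n\ge 0\}$ where $f^0(x)=x$ and $f^n=f\circ f^{n-1}$. A finite system $A=\{a_s+n_s\mathbb{Z}\}_{s=1}^k$ with $a_s,n_s\in\mathbb{Z}$, $n_s>0$, is a cover of $\operatorname{Orb}_f(t)$ if $\operatorname{Orb}_f(t)\subset\bigcup_{s=1}^k(a_s+n_s\mathbb{Z})$. A progression $a_u+n_u\mathbb{Z}$ is essential in the cover if $\{a_s+n_s\mathbb{Z}\}_{s\ne u}$ is not a cover of $\operatorname{Orb}_f(t)$; a minimal cover is a cover in which all the progressions are essential. A $t$-cover is a cover of $\operatorname{Orb}_f(t)$ for which $t\in\bigcap_{s=1}^k(a_s+n_s\mathbb{Z})$. For $A'\subseteq\mathbb{Z}$, the relative density is $$\delta_{f,t}(A')=\lim_{X\to\infty}\frac{|\{x\in A'\cap \operatorname{Orb}_f(t): x\le X\}|}{|\{x\in\operatorname{Orb}_f(t): x\le X\}|},$$ provided this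 limit exists. -}

module Defs where

open import Data.Nat as ℕ using (ℕ; zero; suc)
open import Data.Integer as ℤ using (ℤ; +_)
open import Data.Integer.Divisibility using () renaming (_∣_ to _∣ℤ_)
open import Data.Rational as ℚ using (ℚ; 0ℚ; 1ℚ)
open import Data.Fin using (Fin)
open import Data.Vec using (Vec; []; _∷_)
open import Data.List using (List; length)
open import Data.List.Membership.Propositional using (_∈_)
open import Data.List.Relation.Unary.Unique.Propositional using (Unique)
open import Data.Product using (Σ; ∃; ∃-syntax; _×_; _,_)
open import Relation.Binary.PropositionalEquality using (_≡_; _≢_)
open import Relation.Nullary using (¬_)
open import Function.Bundles using (_⇔_)

-- Polynomials over ℤ, given by coefficient vectors c₀ ∷ c₁ ∷ … ∷ c_d ∷ []

eval : ∀ {m} → Vec ℤ m → ℤ → ℤ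
eval []       x = + 0
eval (c ∷ cs) x = c ℤ.+ x ℤ.* eval cs x

leading : ∀ {d} → Vec ℤ (suc d) → ℤ
leading (c ∷ [])     = c
leading (c ∷ d ∷ cs) = leading (d ∷ cs)

iter : (ℤ → ℤ) → ℕ → ℤ → ℤ
iter f zero    x = x
iter f (suc n) x = f (iter f n x)

Orb : (ℤ → ℤ) → ℤ → ℤ → Set
Orb f t x = ∃[ n ] iter f n t ≡ x

AP : ℤ → ℕ → ℤ → Set
AP a n x = (+ n) ∣ℤ (x ℤ.- a)

IsCover : (ℤ → ℤ) → ℤ → (k : ℕ) → (Fin k → ℤ) → (Fin k → ℕ) → Set
IsCover f t k a n = ∀ x → Orb f t x → ∃[ s ] AP (a s) (n s) x

CoverWithout : (ℤ → ℤ) → ℤ → (k : ℕ) → (Fin k → ℤ) → (Fin k → ℕ) → Fin k → Set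
CoverWithout f t k a n u = ∀ x → Orb f t x → ∃[ s ] (s ≢ u × AP (a s) (n s) x)

Essential : (ℤ → ℤ) → ℤ → (k : ℕ) → (Fin k → ℤ) → (Fin k → ℕ) → Fin k → Set
Essential f t k a n u = ¬ CoverWithout f t k a n u

IsMinimalCover : (ℤ → ℤ) → ℤ → (k : ℕ) → (Fin k → ℤ) → (Fin k → ℕ) → Set
IsMinimalCover f t k a n = IsCover f t k a n × (∀ u → Essential f t k a n u)

IsTCover : (ℤ → ℤ) → ℤ → (k : ℕ) → (Fin k → ℤ) → (Fin k → ℕ) → Set
IsTCover f t k a n = IsCover f t k a n × (∀ s → AP (a s) (n s) t)

CountBelow : (ℤ → Set) → ℤ → ℕ → Set
CountBelow P X c =
  Σ (List ℤ) λ l → Unique l × length l ≡ c × (∀ x → (x ∈ l) ⇔ (P x × x ℤ.≤ X))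

Ratio : (ℤ → ℤ) → ℤ → (ℤ → Set) → ℤ → ℚ → Set
Ratio f t A X q =
  Σ ℕ λ a → Σ ℕ λ b →
    CountBelow (λ x → A x × Orb f t x) X a ×
    CountBelow (Orb f t) X (suc b) ×
    q ≡ (+ a) ℚ./ suc b

-- the limit defining δ_{f,t}(A) exists (as a real number): the ratio is
-- defined for all large X and is Cauchy as X → ∞
DensityExists : (ℤ → ℤ) → ℤ → (ℤ → Set) → Set
DensityExists f t A =
  (∃[ X₀ ] ∀ X → X₀ ℤ.≤ X → ∃[ q ] Ratio f t A X q) ×
  (∀ (ε : ℚ) → 0ℚ ℚ.< ε → ∃[ X₁ ] ∀ X Y q r → X₁ ℤ.≤ X → X₁ ℤ.≤ Y →
     Ratio f t A X q → Ratio f t A Y r → ℚ.∣ q ℚ.- r ∣ ℚ.< ε)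

-- δ_{f,t}(A) exists and δ_{f,t}(A) < 1
-- (given existence of the limit L, L < 1 iff the ratios are eventually
--  bounded by some rational q < 1)
DensityLt1 : (ℤ → ℤ) → ℤ → (ℤ → Set) → Set
DensityLt1 f t A =
  DensityExists f t A ×
  (∃[ q ] (q ℚ.< 1ℚ × ∃[ X₀ ] ∀ X r → X₀ ℤ.≤ X → Ratio f t A X r → r ℚ.≤ q))

-- Since f preserves congruences, a class t + nℤ containing f t contains the whole orbit of t.
-- This gives the first part, and shows that each class of density < 1 misses f t.
--
-- For the second part, a polynomial of degree ≥ 2 eventually stays above or below the
-- diagonal, so the orbit is either bounded above or eventually increasing. If it is bounded,
-- the counts are constant from some X on and their ratio is < 1 because f t is not in the
-- union. If it increases, the orbit points ≤ X are its first M points, and membership in the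
-- union depends only on the residue mod N = ∏ n_s, which is eventually periodic in the index,
-- say with period P. So the number of the first M points lying in the union is h M / P up to
-- a bounded error, and h < P because in every period the orbit leaves the union once (at the
-- index where f t would otherwise reappear mod n_s). The ratios thus converge to h / P < 1.

module Submission where

open import Defs
open import Data.Nat using (ℕ; suc; _≤_; _<_)
open import Data.Integer using (ℤ; +_)
open import Data.Fin using (Fin)
open import Data.Vec using (Vec)
open import Data.Product using (∃-syntax; _×_)
open import Relation.Binary.PropositionalEquality using (_≡_; _≢_)

open import Data.Empty using (⊥-elim)
open import Data.Fin using (punchIn; toℕ; fromℕ<) renaming (zero to fzero; suc to fsuc)
open import Data.Fin.Properties using (punchInᵢ≢i; pigeonhole; fromℕ<-injective; any?; toℕ<n; toℕ-fromℕ<)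
open import Data.Integer as ℤ using (-[1+_]; +[1+_]; _⊖_)
open import Data.Integer.Divisibility.Signed
  using (_∣_; divides; ∣ᵤ⇒∣; ∣⇒∣ᵤ; ∣-trans; ∣m⇒∣-m; ∣m∣n⇒∣m+n; ∣n⇒∣m*n; ∣m⇒∣m*n)
open import Data.Integer.DivMod using (_%ℕ_; _/ℕ_; n%ℕd<d; a≡a%ℕn+[a/ℕn]*n)
import Data.Integer.Properties as ℤP
open import Data.Integer.Tactic.RingSolver using (solve-∀)
open import Data.List using (List; []; _∷_; length; filter; map; downFrom; tabulate)
open import Data.List.Membership.Propositional using (_∈_)
open import Data.List.Membership.Propositional.Properties
  using (∈-filter⁺; ∈-filter⁻; ∈-map⁺; ∈-map⁻; ∈-downFrom⁺; ∈-downFrom⁻; ∈-tabulate⁺)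
open import Data.List.Membership.Setoid.Properties using (index-injective)
open import Data.List.Properties using (filter-notAll; length-map; length-downFrom)
open import Data.List.Relation.Binary.Subset.Propositional using (_⊆_)
import Data.List.Relation.Unary.All as All
open import Data.List.Relation.Unary.Any as Any using (here; there)
open import Data.List.Relation.Unary.Unique.Propositional using (Unique; []; _∷_)
open import Data.List.Relation.Unary.Unique.Propositional.Properties using (filter⁺; map⁺; downFrom⁺)
open import Data.Nat as ℕ using (zero; _∸_)
open import Data.Nat.DivMod using (_/_; _%_; m≡m%n+[m/n]*n; m%n<n)
open import Data.Nat.Divisibility using (_∣?_) renaming (_∣_ to _∣ℕ_)
open import Data.Nat.Induction using (<-rec)
open import Data.Nat.ListAction using (product)
open import Data.Nat.ListAction.Properties using (∈⇒∣product)
import Data.Nat.Properties as ℕP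
import Data.Nat.Tactic.RingSolver as ℕSolver
open import Data.Product using (_,_; proj₁; proj₂)
open import Data.Rational as ℚ using (ℚ; 0ℚ; 1ℚ)
import Data.Rational.Properties as ℚP
import Data.Rational.Unnormalised as ℚᵘ
import Data.Rational.Unnormalised.Properties as ℚᵘP
open import Data.Sum using (_⊎_; inj₁; inj₂)
open import Data.Vec using ([]; _∷_)
open import Function using (_∘_)
open import Function.Bundles using (_⇔_; mk⇔; Equivalence)
open Equivalence using (to; from)
open import Relation.Binary.Definitions using (DecidableEquality; tri<; tri≈; tri>)
open import Relation.Binary.PropositionalEquality
  using (refl; sym; trans; cong; cong₂; subst; subst₂; setoid; module ≡-Reasoning)
open import Relation.Nullary using (¬_; Dec; yes; no; ¬?)
open import Relation.Unary using (Decidable)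

-- Congruences

infix 4 _≡_mod_
record _≡_mod_ (x y : ℤ) (n : ℕ) : Set where
  constructor ≡mod
  field n∣x-y : + n ∣ x ℤ.- y
open _≡_mod_

module _ {n : ℕ} where

  ≡mod-refl : ∀ x → x ≡ x mod n
  ≡mod-refl x = ≡mod (subst (+ n ∣_) (sym (ℤP.+-inverseʳ x)) (divides (+ 0) refl))

  ≡mod-sym : ∀ {x y} → x ≡ y mod n → y ≡ x mod n
  ≡mod-sym {x} {y} (≡mod p) = ≡mod (subst (+ n ∣_) (negate-difference x y) (∣m⇒∣-m p))
    where
    negate-difference : ∀ x y → ℤ.- (x ℤ.- y) ≡ y ℤ.- x
    negate-difference = solve-∀

  ≡mod-trans : ∀ {x y z} → x ≡ y mod n → y ≡ z mod n → x ≡ z mod n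
  ≡mod-trans {x} {y} {z} (≡mod p) (≡mod q) = ≡mod (subst (+ n ∣_) (telescope x y z) (∣m∣n⇒∣m+n p q))
    where
    telescope : ∀ x y z → (x ℤ.- y) ℤ.+ (y ℤ.- z) ≡ x ℤ.- z
    telescope = solve-∀

  +-≡mod : ∀ {a b c d} → a ≡ b mod n → c ≡ d mod n → a ℤ.+ c ≡ b ℤ.+ d mod n
  +-≡mod {a} {b} {c} {d} (≡mod p) (≡mod q) = ≡mod (subst (+ n ∣_) (regroup a b c d) (∣m∣n⇒∣m+n p q))
    where
    regroup : ∀ a b c d → (a ℤ.- b) ℤ.+ (c ℤ.- d) ≡ (a ℤ.+ c) ℤ.- (b ℤ.+ d)
    regroup = solve-∀

  *-≡mod : ∀ {a b c d} → a ≡ b mod n → c ≡ d mod n → a ℤ.* c ≡ b ℤ.* d mod n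
  *-≡mod {a} {b} {c} {d} (≡mod p) (≡mod q) =
    ≡mod (subst (+ n ∣_) (regroup a b c d) (∣m∣n⇒∣m+n (∣n⇒∣m*n a q) (∣m⇒∣m*n d p)))
    where
    regroup : ∀ a b c d → a ℤ.* (c ℤ.- d) ℤ.+ (a ℤ.- b) ℤ.* d ≡ a ℤ.* c ℤ.- b ℤ.* d
    regroup = solve-∀

  AP⇒≡mod : ∀ {a x} → AP a n x → x ≡ a mod n
  AP⇒≡mod p = ≡mod (∣ᵤ⇒∣ p)

  ≡mod⇒AP : ∀ {a x} → x ≡ a mod n → AP a n x
  ≡mod⇒AP (≡mod p) = ∣⇒∣ᵤ p

equal-residues⇒≡mod : ∀ {N x y} .{{_ : ℕ.NonZero N}} → x %ℕ N ≡ y %ℕ N → x ≡ y mod N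
equal-residues⇒≡mod {N} {x} {y} x%N≡y%N = ≡mod (divides (x /ℕ N ℤ.- y /ℕ N) (begin
  x ℤ.- y
    ≡⟨ cong₂ ℤ._-_ (a≡a%ℕn+[a/ℕn]*n x N) (a≡a%ℕn+[a/ℕn]*n y N) ⟩
  (+ (x %ℕ N) ℤ.+ x /ℕ N ℤ.* + N) ℤ.- (+ (y %ℕ N) ℤ.+ y /ℕ N ℤ.* + N)
    ≡⟨ cong (λ r → (+ (x %ℕ N) ℤ.+ x /ℕ N ℤ.* + N) ℤ.- (+ r ℤ.+ y /ℕ N ℤ.* + N)) x%N≡y%N ⟨
  (+ (x %ℕ N) ℤ.+ x /ℕ N ℤ.* + N) ℤ.- (+ (x %ℕ N) ℤ.+ y /ℕ N ℤ.* + N)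
    ≡⟨ cancel (+ (x %ℕ N)) (x /ℕ N) (y /ℕ N) (+ N) ⟩
  (x /ℕ N ℤ.- y /ℕ N) ℤ.* + N
    ∎))
  where
  open ≡-Reasoning
  cancel : ∀ r a b n → (r ℤ.+ a ℤ.* n) ℤ.- (r ℤ.+ b ℤ.* n) ≡ (a ℤ.- b) ℤ.* n
  cancel = solve-∀

≡mod-weaken : ∀ {m n x y} → m ∣ℕ n → x ≡ y mod n → x ≡ y mod m
≡mod-weaken m∣n (≡mod p) = ≡mod (∣-trans (∣ᵤ⇒∣ m∣n) p)

PreservesCongruences : (ℤ → ℤ) → Set
PreservesCongruences f = ∀ {n x y} → x ≡ y mod n → f x ≡ f y mod n

eval-preservesCongruences : ∀ {m} (cs : Vec ℤ m) → PreservesCongruences (eval cs)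
eval-preservesCongruences []       x≡y = ≡mod-refl (+ 0)
eval-preservesCongruences (c ∷ cs) x≡y =
  +-≡mod (≡mod-refl c) (*-≡mod x≡y (eval-preservesCongruences cs x≡y))

-- Orbits and minimal covers

iter-+ : ∀ f m k x → iter f (m ℕ.+ k) x ≡ iter f m (iter f k x)
iter-+ f zero    k x = refl
iter-+ f (suc m) k x = cong f (iter-+ f m k x)

module _ {f : ℤ → ℤ} (pres : PreservesCongruences f) {n : ℕ} where

  iter-≡mod : ∀ r {x y} → x ≡ y mod n → iter f r x ≡ iter f r y mod n
  iter-≡mod zero    x≡y = x≡y
  iter-≡mod (suc r) x≡y = pres (iter-≡mod r x≡y)

  iter-*-≡mod : ∀ {j x} → iter f j x ≡ x mod n → ∀ q → iter f (q ℕ.* j) x ≡ x mod n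
  iter-*-≡mod         return zero    = ≡mod-refl _
  iter-*-≡mod {j} {x} return (suc q) =
    subst (_≡ x mod n) (sym (iter-+ f j (q ℕ.* j) x))
      (≡mod-trans (iter-≡mod j (iter-*-≡mod return q)) return)

  orbit-in-class : ∀ {t} → f t ≡ t mod n → ∀ m → iter f m t ≡ t mod n
  orbit-in-class f[t]≡t m = subst (λ i → iter f i _ ≡ _ mod n) (ℕP.*-identityʳ m) (iter-*-≡mod f[t]≡t m)

minimalCover-of-classes-of-t⇒k≡1 : ∀ {f} → PreservesCongruences f → ∀ t k (n : Fin k → ℕ) →
  IsMinimalCover f t k (λ _ → t) n → k ≡ 1
minimalCover-of-classes-of-t⇒k≡1 pres t zero          n (cover , _) with () ← cover t (0 , refl)
minimalCover-of-classes-of-t⇒k≡1 pres t (suc zero)    n _ = refl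
minimalCover-of-classes-of-t⇒k≡1 {f} pres t (suc (suc k)) n (cover , essential)
  with s , f[t]∈s ← cover (f t) (1 , refl)
  = ⊥-elim (essential (punchIn s fzero) λ where
      x (m , refl) → s , punchInᵢ≢i s fzero ∘ sym , ≡mod⇒AP (orbit-in-class pres (AP⇒≡mod f[t]∈s) m))

-- Counting points below a bound

module _ {A : Set} (_≟_ : DecidableEquality A) where

  Unique-⊆⇒length-≤ : ∀ {xs ys : List A} → Unique xs → xs ⊆ ys → length xs ≤ length ys
  Unique-⊆⇒length-≤ {[]}     _          _      = ℕ.z≤n
  Unique-⊆⇒length-≤ {x ∷ xs} {ys} (x∉xs ∷ u) xs⊆ys =
    ℕP.≤-trans (ℕ.s≤s (Unique-⊆⇒length-≤ u xs⊆ys-x))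
      (filter-notAll ≢x? ys (Any.map (λ x≡y x≢y → x≢y (sym x≡y)) (xs⊆ys (here refl))))
    where
    ≢x? : ∀ z → Dec (z ≢ x)
    ≢x? z = ¬? (z ≟ x)
    xs⊆ys-x : xs ⊆ filter ≢x? ys
    xs⊆ys-x z∈xs = ∈-filter⁺ ≢x? (xs⊆ys (there z∈xs)) (λ z≡x → All.lookup x∉xs z∈xs (sym z≡x))

module _ {X : ℤ} {P Q : ℤ → Set} where

  countBelow-≤ : ∀ {a b} → CountBelow P X a → CountBelow Q X b → (∀ {x} → P x → Q x) → a ≤ b
  countBelow-≤ (l , u , refl , l⇔P) (l' , _ , refl , l'⇔Q) P⊆Q =
    Unique-⊆⇒length-≤ ℤ._≟_ u λ {z} z∈l → let (pz , z≤X) = to (l⇔P z) z∈l in from (l'⇔Q z) (P⊆Q pz , z≤X)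

  countBelow-< : ∀ {a b y} → CountBelow P X a → CountBelow Q X b → (∀ {x} → P x → Q x) →
    Q y → y ℤ.≤ X → ¬ P y → a < b
  countBelow-< {y = y} (l , u , refl , l⇔P) (l' , _ , refl , l'⇔Q) P⊆Q qy y≤X ¬py =
    Unique-⊆⇒length-≤ ℤ._≟_ (All.tabulate y∉l ∷ u) y∷l⊆l'
    where
    y∉l : ∀ {z} → z ∈ l → y ≢ z
    y∉l z∈l refl = ¬py (proj₁ (to (l⇔P y) z∈l))
    y∷l⊆l' : y ∷ l ⊆ l'
    y∷l⊆l' (here refl)  = from (l'⇔Q y) (qy , y≤X)
    y∷l⊆l' (there z∈l) = let (pz , z≤X) = to (l⇔P _) z∈l in from (l'⇔Q _) (P⊆Q pz , z≤X)

  countBelow-filter : (Q? : Decidable Q) {b : ℕ} (c : CountBelow P X b) →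
    CountBelow (λ x → Q x × P x) X (length (filter Q? (proj₁ c)))
  countBelow-filter Q? (l , u , _ , l⇔P) = filter Q? l , filter⁺ Q? u , refl , λ x → mk⇔
    (λ x∈ → let (x∈l , qx) = ∈-filter⁻ Q? x∈ ; (px , x≤X) = to (l⇔P x) x∈l in (qx , px) , x≤X)
    (λ ((qx , px) , x≤X) → ∈-filter⁺ Q? (from (l⇔P x) (px , x≤X)) qx)

countBelow-≡ : ∀ {X} {P Q : ℤ → Set} {a b} → CountBelow P X a → CountBelow Q X b →
  (∀ {x} → P x → Q x) → (∀ {x} → Q x → P x) → a ≡ b
countBelow-≡ cP cQ P⊆Q Q⊆P = ℕP.≤-antisym (countBelow-≤ cP cQ P⊆Q) (countBelow-≤ cQ cP Q⊆P)

countBelow-raise : ∀ {P : ℤ → Set} {Z X a} → (∀ {x} → P x → x ℤ.≤ Z) → Z ℤ.≤ X →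
  CountBelow P Z a → CountBelow P X a
countBelow-raise P≤Z Z≤X (l , u , len , l⇔P) = l , u , len , λ x → mk⇔
  (λ x∈l → let (px , _) = to (l⇔P x) x∈l in px , ℤP.≤-trans (P≤Z px) Z≤X)
  (λ (px , _) → from (l⇔P x) (px , P≤Z px))

-- Bounded and periodic orbits

OrbitBoundedAbove : (ℤ → ℤ) → ℤ → Set
OrbitBoundedAbove f t = ∃[ Z ] ∀ m → iter f m t ℤ.≤ Z

OrbitEventuallyIncreasing : (ℤ → ℤ) → ℤ → Set
OrbitEventuallyIncreasing f t = ∃[ m₀ ] ∀ m → m₀ ≤ m → iter f m t ℤ.< iter f (suc m) t

module _ (f : ℤ → ℤ) (t : ℤ) where

  private
    orb : ℕ → ℤ
    orb m = iter f m t

  orbit-shift : ∀ {i j} → orb i ≡ orb j → ∀ y → orb (y ℕ.+ i) ≡ orb (y ℕ.+ j)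
  orbit-shift {i} {j} orb[i]≡orb[j] y =
    trans (iter-+ f y i t) (trans (cong (iter f y) orb[i]≡orb[j]) (sym (iter-+ f y j t)))

  orbit-shift-mod : PreservesCongruences f → ∀ {i j n} → orb i ≡ orb j mod n →
    ∀ y → orb (y ℕ.+ i) ≡ orb (y ℕ.+ j) mod n
  orbit-shift-mod pres {i} {j} orb[i]≡orb[j] y =
    subst₂ (_≡_mod _) (sym (iter-+ f y i t)) (sym (iter-+ f y j t)) (iter-≡mod pres y orb[i]≡orb[j])

  orbit-repeat⇒bounded : ∀ {i j X} → orb i ≡ orb j → i < j → (∀ m → m < j → orb m ℤ.≤ X) → ∀ m → orb m ℤ.≤ X
  orbit-repeat⇒bounded {i} {j} {X} orb[i]≡orb[j] i<j prefix = <-rec (λ m → orb m ℤ.≤ X) bounded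
    where
    bounded : ∀ m → (∀ {m'} → m' < m → orb m' ℤ.≤ X) → orb m ℤ.≤ X
    bounded m earlier with m ℕ.<? j
    ... | yes m<j = prefix m m<j
    ... | no m≮j  = subst (ℤ._≤ X) (trans (orbit-shift orb[i]≡orb[j] y) (cong orb (ℕP.m∸n+n≡m j≤m)))
                      (earlier (subst (y ℕ.+ i <_) (ℕP.m∸n+n≡m j≤m) (ℕP.+-monoʳ-< y i<j)))
      where
      j≤m = ℕP.≮⇒≥ m≮j
      y = m ∸ j

  orbit-eventually-periodic-mod : PreservesCongruences f → ∀ N .{{_ : ℕ.NonZero N}} →
    ∃[ m₁ ] ∃[ p ] ∀ x → m₁ ≤ x → orb (suc p ℕ.+ x) ≡ orb x mod N
  orbit-eventually-periodic-mod pres N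
    with i , j , i<j , same-residue ← pigeonhole (ℕP.n<1+n N) (λ i → fromℕ< (n%ℕd<d (orb (toℕ i)) N))
    with p , 1+i+p≡j ← ℕP.m≤n⇒∃[o]m+o≡n i<j
    = toℕ i , p , λ x i≤x → ≡mod-sym (subst₂ (λ a b → orb a ≡ orb b mod N)
        (ℕP.m∸n+n≡m i≤x) (reassociate i≤x) (orbit-shift-mod pres orb[i]≡orb[j] (x ∸ toℕ i)))
    where
    orb[i]≡orb[j] : orb (toℕ i) ≡ orb (toℕ j) mod N
    orb[i]≡orb[j] = equal-residues⇒≡mod (fromℕ<-injective _ _ _ _ same-residue)
    reassociate : ∀ {x} → toℕ i ≤ x → x ∸ toℕ i ℕ.+ toℕ j ≡ suc p ℕ.+ x
    reassociate {x} i≤x = begin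
      x ∸ toℕ i ℕ.+ toℕ j              ≡⟨ cong (x ∸ toℕ i ℕ.+_) 1+i+p≡j ⟨
      x ∸ toℕ i ℕ.+ (suc (toℕ i) ℕ.+ p) ≡⟨ regroup (x ∸ toℕ i) (toℕ i) p ⟩
      suc p ℕ.+ (x ∸ toℕ i ℕ.+ toℕ i)   ≡⟨ cong (suc p ℕ.+_) (ℕP.m∸n+n≡m i≤x) ⟩
      suc p ℕ.+ x                       ∎
      where
      open ≡-Reasoning
      regroup : ∀ y i p → y ℕ.+ (suc i ℕ.+ p) ≡ suc p ℕ.+ (y ℕ.+ i)
      regroup = ℕSolver.solve-∀

  orbit-periods : ∀ {N m₁ p} → (∀ x → m₁ ≤ x → orb (suc p ℕ.+ x) ≡ orb x mod N) →
    ∀ q x → m₁ ≤ x → orb (q ℕ.* suc p ℕ.+ x) ≡ orb x mod N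
  orbit-periods         periodic zero    x m₁≤x = ≡mod-refl _
  orbit-periods {N} {p = p} periodic (suc q) x m₁≤x =
    subst (λ i → orb i ≡ orb x mod N) (sym (ℕP.+-assoc (suc p) (q ℕ.* suc p) x))
      (≡mod-trans (periodic (q ℕ.* suc p ℕ.+ x) (ℕP.≤-trans m₁≤x (ℕP.m≤n+m x (q ℕ.* suc p))))
                  (orbit-periods periodic q x m₁≤x))

  -- With Q = m₁ (p + 1): if orb (Q + 1) ≡ t mod n, the orbit returns to t mod n at index
  -- (p + 1)(Q + 1) = (1 + p m₁)(p + 1) + Q, where periodicity mod N gives orb Q; so
  -- f t ≡ f (orb Q) = orb (Q + 1) ≡ t mod n.
  orbit-outside-class : PreservesCongruences f → ∀ {n N m₁ p} → n ∣ℕ N →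
    (∀ x → m₁ ≤ x → orb (suc p ℕ.+ x) ≡ orb x mod N) →
    ¬ (f t ≡ t mod n) → ¬ (orb (suc (m₁ ℕ.* suc p)) ≡ t mod n)
  orbit-outside-class pres {n} {N} {m₁} {p} n∣N periodic f[t]≢t returned =
    f[t]≢t (≡mod-trans (≡mod-sym (pres orb[Q]≡t)) returned)
    where
    Q : ℕ
    Q = m₁ ℕ.* suc p
    regroup : ∀ p m → suc p ℕ.* suc (m ℕ.* suc p) ≡ suc (p ℕ.* m) ℕ.* suc p ℕ.+ m ℕ.* suc p
    regroup = ℕSolver.solve-∀
    orb[Q]≡t : orb Q ≡ t mod n
    orb[Q]≡t = ≡mod-trans
      (≡mod-sym (≡mod-weaken n∣N
        (orbit-periods {N} {m₁} {p} periodic (suc (p ℕ.* m₁)) Q (ℕP.m≤m*n m₁ (suc p)))))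
      (subst (λ i → orb i ≡ t mod n) (regroup p m₁) (iter-*-≡mod pres {j = suc Q} returned (suc p)))

  -- The count is what makes the maximum of f over the orbit points ≤ X finite.
  contracting-orbit-bounded : ∀ {B X c} → (∀ x → B ℤ.≤ x → f x ℤ.< x) → B ℤ.≤ X →
    CountBelow (Orb f t) X c → OrbitBoundedAbove f t
  contracting-orbit-bounded {B} {X} contracting B≤X (L , _ , _ , L⇔) = X ℤ.⊔ imageMax L , bounded
    where
    imageMax : List ℤ → ℤ
    imageMax []       = t
    imageMax (x ∷ xs) = f x ℤ.⊔ imageMax xs
    t≤imageMax : ∀ xs → t ℤ.≤ imageMax xs
    t≤imageMax []       = ℤP.≤-refl
    t≤imageMax (x ∷ xs) = ℤP.≤-trans (t≤imageMax xs) (ℤP.i≤j⊔i (f x) (imageMax xs))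
    f≤imageMax : ∀ {x xs} → x ∈ xs → f x ℤ.≤ imageMax xs
    f≤imageMax {xs = y ∷ ys} (here refl)  = ℤP.i≤i⊔j (f y) (imageMax ys)
    f≤imageMax {xs = y ∷ ys} (there x∈ys) = ℤP.≤-trans (f≤imageMax x∈ys) (ℤP.i≤j⊔i (f y) (imageMax ys))
    bounded : ∀ m → orb m ℤ.≤ X ℤ.⊔ imageMax L
    bounded zero    = ℤP.≤-trans (t≤imageMax L) (ℤP.i≤j⊔i X (imageMax L))
    bounded (suc m) with orb m ℤ.≤? X
    ... | yes orb[m]≤X =
      ℤP.≤-trans (f≤imageMax (from (L⇔ (orb m)) ((m , refl) , orb[m]≤X))) (ℤP.i≤j⊔i X (imageMax L))
    ... | no orb[m]≰X  = ℤP.<⇒≤ (ℤP.<-≤-trans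
            (contracting (orb m) (ℤP.≤-trans B≤X (ℤP.<⇒≤ (ℤP.≰⇒> orb[m]≰X)))) (bounded m))

  expanding-orbit-increasing : ∀ {B m₀} → (∀ x → B ℤ.≤ x → x ℤ.< f x) → B ℤ.≤ orb m₀ →
    ∀ m → m₀ ≤ m → orb m ℤ.< orb (suc m)
  expanding-orbit-increasing {B} {m₀} expanding B≤orb[m₀] m m₀≤m =
    expanding (orb m) (subst (λ i → B ℤ.≤ orb i) (ℕP.m∸n+n≡m m₀≤m) (stays-above (m ∸ m₀)))
    where
    stays-above : ∀ j → B ℤ.≤ orb (j ℕ.+ m₀)
    stays-above zero    = B≤orb[m₀]
    stays-above (suc j) = ℤP.≤-trans (stays-above j) (ℤP.<⇒≤ (expanding _ (stays-above j)))

  -- Either some of the first c + 1 orbit points exceeds X, from where the orbit increases,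
  -- or they all lie among the c orbit points ≤ X, so two coincide and the orbit cycles.
  expanding-orbit-bounded-or-increasing : ∀ {B X c} → (∀ x → B ℤ.≤ x → x ℤ.< f x) → B ℤ.≤ X →
    CountBelow (Orb f t) X c → OrbitBoundedAbove f t ⊎ OrbitEventuallyIncreasing f t
  expanding-orbit-bounded-or-increasing {B} {X} expanding B≤X (L , _ , refl , L⇔)
    with any? (λ (i : Fin (suc (length L))) → X ℤ.<? orb (toℕ i))
  ... | yes (i , X<orb[i]) =
    inj₂ (toℕ i , expanding-orbit-increasing expanding (ℤP.≤-trans B≤X (ℤP.<⇒≤ X<orb[i])))
  ... | no none-above =
    let (i , j , i<j , same-position) = pigeonhole (ℕP.n<1+n (length L)) position
    in inj₁ (X , orbit-repeat⇒bounded (index-injective (setoid ℤ) (listed i) (listed j) same-position) i<j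
                   (λ m m<j → prefix m (ℕP.<-trans m<j (toℕ<n j))))
    where
    prefix : ∀ m → m < suc (length L) → orb m ℤ.≤ X
    prefix m m<1+c = ℤP.≮⇒≥ λ X<orb[m] →
      none-above (fromℕ< m<1+c , subst (λ i → X ℤ.< orb i) (sym (toℕ-fromℕ< m<1+c)) X<orb[m])
    listed : ∀ i → orb (toℕ i) ∈ L
    listed i = from (L⇔ _) ((toℕ i , refl) , prefix (toℕ i) (toℕ<n i))
    position : Fin (suc (length L)) → Fin (length L)
    position i = Any.index (listed i)

-- Fractions

frac : ℕ → ℕ → ℚ
frac a b = + a ℚ./ suc b

private
  toℚᵘ-frac : ∀ a b → ℚ.toℚᵘ (frac a b) ℚᵘ.≃ ℚᵘ.mkℚᵘ (+ a) b
  toℚᵘ-frac a b = ℚP.toℚᵘ-fromℚᵘ (ℚᵘ.mkℚᵘ (+ a) b)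

frac-≤ : ∀ {a b a' b'} → a ℕ.* suc b' ≤ a' ℕ.* suc b → frac a b ℚ.≤ frac a' b'
frac-≤ {a} {b} {a'} {b'} cross = ℚP.toℚᵘ-cancel-≤
  (ℚᵘP.≤-respˡ-≃ (ℚᵘP.≃-sym (toℚᵘ-frac a b)) (ℚᵘP.≤-respʳ-≃ (ℚᵘP.≃-sym (toℚᵘ-frac a' b'))
    (ℚᵘ.*≤* (subst₂ ℤ._≤_ (ℤP.pos-* a (suc b')) (ℤP.pos-* a' (suc b)) (ℤ.+≤+ cross)))))

frac-< : ∀ {a b a' b'} → a ℕ.* suc b' < a' ℕ.* suc b → frac a b ℚ.< frac a' b'
frac-< {a} {b} {a'} {b'} cross = ℚP.toℚᵘ-cancel-<
  (ℚᵘP.<-respˡ-≃ (ℚᵘP.≃-sym (toℚᵘ-frac a b)) (ℚᵘP.<-respʳ-≃ (ℚᵘP.≃-sym (toℚᵘ-frac a' b'))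
    (ℚᵘ.*<* (subst₂ ℤ._<_ (ℤP.pos-* a (suc b')) (ℤP.pos-* a' (suc b)) (ℤ.+<+ cross)))))

frac<1 : ∀ {a b} → a ≤ b → frac a b ℚ.< 1ℚ
frac<1 {a} {b} a≤b = frac-< {a} {b} {1} {0}
  (subst₂ _<_ (sym (ℕP.*-identityʳ a)) (sym (ℕP.+-identityʳ (suc b))) (ℕ.s≤s a≤b))

1≤frac : ∀ b → 1ℚ ℚ.≤ frac (suc b) b
1≤frac b = frac-≤ {1} {0} {suc b} {b}
  (ℕP.≤-reflexive (trans (ℕP.+-identityʳ (suc b)) (sym (ℕP.*-identityʳ (suc b)))))

∣q-q∣<ε : ∀ q {ε} → 0ℚ ℚ.< ε → ℚ.∣ q ℚ.- q ∣ ℚ.< ε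
∣q-q∣<ε q 0<ε = subst (ℚ._< _) (sym (cong ℚ.∣_∣ (ℚP.+-inverseʳ q))) 0<ε

-- The last hypothesis says D / ((b + 1)(b' + 1)) < ε.
frac-distance-< : ∀ a b a' b' D (ε : ℚ) → 0ℚ ℚ.< ε →
  a ℕ.* suc b' ≤ a' ℕ.* suc b ℕ.+ D → a' ℕ.* suc b ≤ a ℕ.* suc b' ℕ.+ D →
  D ℕ.* ℚ.↧ₙ ε < ℤ.∣ ℚ.↥ ε ∣ ℕ.* (suc b ℕ.* suc b') →
  ℚ.∣ frac a b ℚ.- frac a' b' ∣ ℚ.< ε
frac-distance-< a b a' b' D (ℚ.mkℚ -[1+ _ ] _ _) (ℚ.*<* ())
frac-distance-< a b a' b' D ε@(ℚ.mkℚ (+ p) dm _) _ upper lower small =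
  ℚP.toℚᵘ-cancel-< (ℚᵘP.<-respˡ-≃ (ℚᵘP.≃-sym toℚᵘ-distance) (ℚᵘ.*<* cross))
  where
  q r : ℚ
  q = frac a b
  r = frac a' b'
  toℚᵘ-distance : ℚ.toℚᵘ (ℚ.∣ q ℚ.- r ∣) ℚᵘ.≃ ℚᵘ.∣ ℚᵘ.mkℚᵘ (+ a) b ℚᵘ.- ℚᵘ.mkℚᵘ (+ a') b' ∣
  toℚᵘ-distance = ℚᵘP.≃-trans (ℚP.toℚᵘ-homo-∣-∣ (q ℚ.- r)) (ℚᵘP.∣-∣-cong
    (ℚᵘP.≃-trans (ℚP.toℚᵘ-homo-+ q (ℚ.- r))
      (ℚᵘP.+-cong (toℚᵘ-frac a b) (ℚᵘP.≃-trans (ℚP.toℚᵘ-homo‿- r) (ℚᵘP.-‿cong (toℚᵘ-frac a' b'))))))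
  numerator : ℤ
  numerator = + a ℤ.* + suc b' ℤ.+ ℤ.- (+ a') ℤ.* + suc b
  numerator≡ : numerator ≡ (a ℕ.* suc b') ⊖ (a' ℕ.* suc b)
  numerator≡ = trans
    (cong₂ ℤ._+_ (sym (ℤP.pos-* a (suc b')))
      (trans (sym (ℤP.neg-distribˡ-* (+ a') (+ suc b))) (cong ℤ.-_ (sym (ℤP.pos-* a' (suc b))))))
    (ℤP.m-n≡m⊖n (a ℕ.* suc b') (a' ℕ.* suc b))
  ∣numerator∣≤D : ℤ.∣ numerator ∣ ≤ D
  ∣numerator∣≤D = subst (_≤ D) (cong ℤ.∣_∣ (sym numerator≡)) (∣m⊖n∣≤ _ _ upper lower)
    where
    ∣m⊖n∣≤ : ∀ m n → m ≤ n ℕ.+ D → n ≤ m ℕ.+ D → ℤ.∣ m ⊖ n ∣ ≤ D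
    ∣m⊖n∣≤ m n m≤n+D n≤m+D with ℕP.≤-total n m
    ... | inj₁ n≤m = subst (_≤ D) (cong ℤ.∣_∣ (sym (ℤP.⊖-≥ n≤m))) (ℕP.m≤n+o⇒m∸n≤o m n m≤n+D)
    ... | inj₂ m≤n = subst (_≤ D) (trans (cong ℤ.∣_∣ (sym (ℤP.⊖-≥ m≤n))) (ℤP.∣m⊖n∣≡∣n⊖m∣ n m))
                       (ℕP.m≤n+o⇒m∸n≤o n m n≤m+D)
  cross : + ℤ.∣ numerator ∣ ℤ.* + ℚ.↧ₙ ε ℤ.< + p ℤ.* + (suc b ℕ.* suc b')
  cross = subst₂ ℤ._<_ (ℤP.pos-* ℤ.∣ numerator ∣ (ℚ.↧ₙ ε)) (ℤP.pos-* p (suc b ℕ.* suc b'))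
    (ℤ.+<+ (ℕP.≤-<-trans (ℕP.*-monoˡ-≤ (ℚ.↧ₙ ε) ∣numerator∣≤D) small))

-- Relative densities

CountsAt : (ℤ → ℤ) → ℤ → (ℤ → Set) → ℤ → ℕ → ℕ → Set
CountsAt f t U X a b = CountBelow (λ x → U x × Orb f t x) X a × CountBelow (Orb f t) X (suc b)

-- freq A b is the frequency A M / M at M = b + 1.
freq : (ℕ → ℕ) → ℕ → ℚ
freq A b = frac (A (suc b)) b

FrequencyCauchy : (ℕ → ℕ) → Set
FrequencyCauchy A =
  ∀ ε → 0ℚ ℚ.< ε → ∃[ L ] ∀ b b' → L ≤ b → L ≤ b' → ℚ.∣ freq A b ℚ.- freq A b' ∣ ℚ.< ε

FrequencyEventuallyBelow1 : (ℕ → ℕ) → Set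
FrequencyEventuallyBelow1 A = ∃[ q ] q ℚ.< 1ℚ × ∃[ L ] ∀ b → L ≤ b → freq A b ℚ.≤ q

module _ {f : ℤ → ℤ} {t : ℤ} {U : ℤ → Set} where

  ratio-of-counts : ∀ {X a b} → CountsAt f t U X a b → Ratio f t U X (frac a b)
  ratio-of-counts {a = a} {b} (cU , cO) = a , b , cU , cO , refl

  ratio-unique : ∀ {X a b q} → CountsAt f t U X a b → Ratio f t U X q → q ≡ frac a b
  ratio-unique (cU , cO) (_ , _ , cU' , cO' , q≡) =
    trans q≡ (cong₂ frac (countBelow-≡ cU' cU (λ p → p) (λ p → p))
                         (ℕP.suc-injective (countBelow-≡ cO' cO (λ p → p) (λ p → p))))

  densityLt1-of-stable-counts : ∀ {Z a b} → (∀ X → Z ℤ.≤ X → CountsAt f t U X a b) → a ≤ b →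
    DensityLt1 f t U
  densityLt1-of-stable-counts {Z} {a} {b} counts a≤b =
    ( (Z , λ X Z≤X → frac a b , ratio-of-counts (counts X Z≤X))
    , λ ε 0<ε → Z , λ X Y q r Z≤X Z≤Y qX rY →
        subst₂ (λ q r → ℚ.∣ q ℚ.- r ∣ ℚ.< ε)
          (sym (ratio-unique (counts X Z≤X) qX)) (sym (ratio-unique (counts Y Z≤Y) rY))
          (∣q-q∣<ε (frac a b) 0<ε) )
    , frac a b , frac<1 a≤b , Z , λ X r Z≤X rX → ℚP.≤-reflexive (ratio-unique (counts X Z≤X) rX)

  densityLt1-of-frequency : (A : ℕ → ℕ) → FrequencyCauchy A → FrequencyEventuallyBelow1 A →
    (∀ L → ∃[ X₁ ] ∀ X → X₁ ℤ.≤ X → ∃[ b ] L ≤ b × CountsAt f t U X (A (suc b)) b) →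
    DensityLt1 f t U
  densityLt1-of-frequency A cauchy (q , q<1 , L₀ , below) counts =
    ( (X₀ , λ X X₀≤X → let (b , _ , cX) = counts₀ X X₀≤X in freq A b , ratio-of-counts cX)
    , λ ε 0<ε → let (L , close) = cauchy ε 0<ε ; (X₁ , countsL) = counts L in
        X₁ , λ X Y r r' X₁≤X X₁≤Y rX r'Y →
          let (b , L≤b , cX) = countsL X X₁≤X ; (b' , L≤b' , cY) = countsL Y X₁≤Y in
          subst₂ (λ r r' → ℚ.∣ r ℚ.- r' ∣ ℚ.< ε) (sym (ratio-unique cX rX)) (sym (ratio-unique cY r'Y))
            (close b b' L≤b L≤b') )
    , q , q<1 , proj₁ (counts L₀) , λ X r X₁≤X rX →
        let (b , L₀≤b , cX) = proj₂ (counts L₀) X X₁≤X in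
        subst (ℚ._≤ q) (sym (ratio-unique cX rX)) (below b L₀≤b)
    where
    X₀ = proj₁ (counts 0)
    counts₀ = proj₂ (counts 0)

  full⇒¬densityLt1 : (∀ {x} → Orb f t x → U x) → ¬ DensityLt1 f t U
  full⇒¬densityLt1 full (((X₀ , ratios) , _) , q , q<1 , X₁ , below) =
    ℚP.<-irrefl refl (ℚP.≤-<-trans (ℚP.≤-trans (1≤ratio ratio) (below X r (ℤP.i≤j⊔i X₀ X₁) ratio)) q<1)
    where
    1≤ratio : ∀ {X r} → Ratio f t U X r → 1ℚ ℚ.≤ r
    1≤ratio (a , b , cU , cO , r≡) = subst (1ℚ ℚ.≤_)
      (sym (trans r≡ (cong (λ a → frac a b) (countBelow-≡ cU cO proj₂ (λ o → full o , o))))) (1≤frac b)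
    X = X₀ ℤ.⊔ X₁
    r = proj₁ (ratios X (ℤP.i≤i⊔j X₀ X₁))
    ratio = proj₂ (ratios X (ℤP.i≤i⊔j X₀ X₁))

densityLt1-of-bounded-orbit : ∀ {f t Z b} {U : ℤ → Set} → Decidable U → (∀ m → iter f m t ℤ.≤ Z) →
  CountBelow (Orb f t) Z (suc b) → ∀ {y} → Orb f t y → ¬ U y → DensityLt1 f t U
densityLt1-of-bounded-orbit {f} {t} {Z} {b} U? bounded cO {y} orbit-y ¬Uy =
  densityLt1-of-stable-counts counts
    (ℕP.≤-pred (countBelow-< cU cO proj₂ orbit-y (orbit≤Z orbit-y) λ (Uy , _) → ¬Uy Uy))
  where
  orbit≤Z : ∀ {x} → Orb f t x → x ℤ.≤ Z
  orbit≤Z (m , refl) = bounded m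
  cU = countBelow-filter U? cO
  counts : ∀ X → Z ℤ.≤ X → CountsAt f t _ X _ b
  counts X Z≤X = countBelow-raise (orbit≤Z ∘ proj₂) Z≤X cU , countBelow-raise orbit≤Z Z≤X cO

-- Frequencies of eventually periodic predicates

indicator : ∀ {Q : Set} → Dec Q → ℕ
indicator (yes _) = 1
indicator (no _)  = 0

indicator≤1 : ∀ {Q : Set} (Q? : Dec Q) → indicator Q? ≤ 1
indicator≤1 (yes _) = ℕP.≤-refl
indicator≤1 (no _)  = ℕ.z≤n

indicator-cong : ∀ {Q R : Set} → Q ⇔ R → (Q? : Dec Q) (R? : Dec R) → indicator Q? ≡ indicator R?
indicator-cong Q⇔R (yes _) (yes _) = refl
indicator-cong Q⇔R (no _)  (no _)  = refl
indicator-cong Q⇔R (yes q) (no ¬r) = ⊥-elim (¬r (to Q⇔R q))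
indicator-cong Q⇔R (no ¬q) (yes r) = ⊥-elim (¬q (from Q⇔R r))

indicator-¬ : ∀ {Q : Set} → ¬ Q → (Q? : Dec Q) → indicator Q? ≡ 0
indicator-¬ ¬q (yes q) = ⊥-elim (¬q q)
indicator-¬ ¬q (no _)  = refl

divide-by-period : ∀ m₁ p M → m₁ ≤ M → ∃[ q ] ∃[ x ] M ≡ q ℕ.* suc p ℕ.+ x × m₁ ≤ x × x ≤ suc p ℕ.+ m₁
divide-by-period m₁ p M m₁≤M = y / suc p , y % suc p ℕ.+ m₁ , M≡ , ℕP.m≤n+m m₁ (y % suc p) ,
  ℕP.+-monoˡ-≤ m₁ (ℕP.<⇒≤ (m%n<n y (suc p)))
  where
  y = M ∸ m₁
  open ≡-Reasoning
  M≡ : M ≡ (y / suc p) ℕ.* suc p ℕ.+ (y % suc p ℕ.+ m₁)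
  M≡ = begin
    M                                           ≡⟨ ℕP.m∸n+n≡m m₁≤M ⟨
    y ℕ.+ m₁                                    ≡⟨ cong (ℕ._+ m₁) (m≡m%n+[m/n]*n y (suc p)) ⟩
    y % suc p ℕ.+ (y / suc p) ℕ.* suc p ℕ.+ m₁  ≡⟨ cong (ℕ._+ m₁) (ℕP.+-comm (y % suc p) _) ⟩
    (y / suc p) ℕ.* suc p ℕ.+ y % suc p ℕ.+ m₁  ≡⟨ ℕP.+-assoc ((y / suc p) ℕ.* suc p) (y % suc p) m₁ ⟩
    (y / suc p) ℕ.* suc p ℕ.+ (y % suc p ℕ.+ m₁) ∎

[1+p]*x≤[1+p]*y+z⇒x≤y+z : ∀ p x y z → suc p ℕ.* x ≤ suc p ℕ.* y ℕ.+ z → x ≤ y ℕ.+ z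
[1+p]*x≤[1+p]*y+z⇒x≤y+z p x y z px≤py+z = ℕP.*-cancelˡ-≤ (suc p) (begin
  suc p ℕ.* x                  ≤⟨ px≤py+z ⟩
  suc p ℕ.* y ℕ.+ z            ≤⟨ ℕP.+-monoʳ-≤ (suc p ℕ.* y) (ℕP.m≤n*m z (suc p)) ⟩
  suc p ℕ.* y ℕ.+ suc p ℕ.* z  ≡⟨ ℕP.*-distribˡ-+ (suc p) y z ⟨
  suc p ℕ.* (y ℕ.+ z)          ∎)
  where open ℕP.≤-Reasoning

2*z<m⇒2*z<n⇒z*[m+n]<m*n : ∀ z m n → 2 ℕ.* z < m → 2 ℕ.* z < n → z ℕ.* (m ℕ.+ n) < m ℕ.* n
2*z<m⇒2*z<n⇒z*[m+n]<m*n z m n 2z<m 2z<n = ℕP.*-cancelˡ-< 2 _ _ (subst₂ _<_ (lhs z m n) (rhs m n)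
  (ℕP.+-mono-< (ℕP.*-monoˡ-< n {{ℕ.>-nonZero (ℕP.<-≤-trans (ℕ.s≤s ℕ.z≤n) 2z<n)}} 2z<m)
               (ℕP.*-monoˡ-< m {{ℕ.>-nonZero (ℕP.<-≤-trans (ℕ.s≤s ℕ.z≤n) 2z<m)}} 2z<n)))
  where
  lhs : ∀ z m n → 2 ℕ.* z ℕ.* n ℕ.+ 2 ℕ.* z ℕ.* m ≡ 2 ℕ.* (z ℕ.* (m ℕ.+ n))
  lhs = ℕSolver.solve-∀
  rhs : ∀ m n → m ℕ.* n ℕ.+ n ℕ.* m ≡ 2 ℕ.* (m ℕ.* n)
  rhs = ℕSolver.solve-∀

module Counting {B : ℕ → Set} (B? : Decidable B) where

  count : ℕ → ℕ
  count zero    = 0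
  count (suc M) = indicator (B? M) ℕ.+ count M

  count-+-≤ : ∀ j M → count (j ℕ.+ M) ≤ j ℕ.+ count M
  count-+-≤ zero    M = ℕP.≤-refl
  count-+-≤ (suc j) M = ℕP.+-mono-≤ (indicator≤1 (B? (j ℕ.+ M))) (count-+-≤ j M)

  count-mono : ∀ j M → count M ≤ count (j ℕ.+ M)
  count-mono zero    M = ℕP.≤-refl
  count-mono (suc j) M = ℕP.≤-trans (count-mono j M) (ℕP.m≤n+m _ (indicator (B? (j ℕ.+ M))))

  count≤ : ∀ M → count M ≤ M
  count≤ M = subst₂ _≤_ (cong count (ℕP.+-identityʳ M)) (ℕP.+-identityʳ M) (count-+-≤ M 0)

  module Periodic (m₁ p : ℕ) (periodic : ∀ x → m₁ ≤ x → B (suc p ℕ.+ x) ⇔ B x)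
                  (r₀ : ℕ) (m₁≤r₀ : m₁ ≤ r₀) (¬B[r₀] : ¬ B r₀) where

    private
      P : ℕ
      P = suc p

    h : ℕ
    h = count (P ℕ.+ m₁) ∸ count m₁

    count-period : ∀ x → m₁ ≤ x → count (P ℕ.+ x) ≡ h ℕ.+ count x
    count-period x m₁≤x =
      subst (λ x → count (P ℕ.+ x) ≡ h ℕ.+ count x) (ℕP.m∸n+n≡m m₁≤x) (shifted (x ∸ m₁))
      where
      shifted : ∀ i → count (P ℕ.+ (i ℕ.+ m₁)) ≡ h ℕ.+ count (i ℕ.+ m₁)
      shifted zero    = sym (ℕP.m∸n+n≡m (count-mono P m₁))
      shifted (suc i) = begin
        count (P ℕ.+ suc (i ℕ.+ m₁))                              ≡⟨ cong count (ℕP.+-suc P (i ℕ.+ m₁)) ⟩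
        indicator (B? (P ℕ.+ (i ℕ.+ m₁))) ℕ.+ count (P ℕ.+ (i ℕ.+ m₁))
          ≡⟨ cong₂ ℕ._+_ (indicator-cong (periodic (i ℕ.+ m₁) (ℕP.m≤n+m m₁ i)) (B? _) (B? _)) (shifted i) ⟩
        indicator (B? (i ℕ.+ m₁)) ℕ.+ (h ℕ.+ count (i ℕ.+ m₁))    ≡⟨ swap-+ (indicator (B? (i ℕ.+ m₁))) h _ ⟩
        h ℕ.+ count (suc i ℕ.+ m₁)                                ∎
        where
        open ≡-Reasoning
        swap-+ : ∀ a b c → a ℕ.+ (b ℕ.+ c) ≡ b ℕ.+ (a ℕ.+ c)
        swap-+ = ℕSolver.solve-∀

    count-periods : ∀ q x → m₁ ≤ x → count (q ℕ.* P ℕ.+ x) ≡ q ℕ.* h ℕ.+ count x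
    count-periods zero    x m₁≤x = refl
    count-periods (suc q) x m₁≤x = begin
      count (P ℕ.+ q ℕ.* P ℕ.+ x)    ≡⟨ cong count (ℕP.+-assoc P (q ℕ.* P) x) ⟩
      count (P ℕ.+ (q ℕ.* P ℕ.+ x))  ≡⟨ count-period _ (ℕP.≤-trans m₁≤x (ℕP.m≤n+m x (q ℕ.* P))) ⟩
      h ℕ.+ count (q ℕ.* P ℕ.+ x)    ≡⟨ cong (h ℕ.+_) (count-periods q x m₁≤x) ⟩
      h ℕ.+ (q ℕ.* h ℕ.+ count x)    ≡⟨ ℕP.+-assoc h (q ℕ.* h) (count x) ⟨
      h ℕ.+ q ℕ.* h ℕ.+ count x      ∎
      where open ≡-Reasoning

    -- The period starting at r₀, where B fails, has at most p indices where B holds.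
    h≤p : h ≤ p
    h≤p = ℕP.+-cancelʳ-≤ (count r₀) h p (begin
      h ℕ.+ count r₀          ≡⟨ count-period r₀ m₁≤r₀ ⟨
      count (P ℕ.+ r₀)        ≡⟨ cong count (ℕP.+-suc p r₀) ⟨
      count (p ℕ.+ suc r₀)    ≤⟨ count-+-≤ p (suc r₀) ⟩
      p ℕ.+ count (suc r₀)    ≡⟨ cong (λ i → p ℕ.+ (i ℕ.+ count r₀)) (indicator-¬ ¬B[r₀] (B? r₀)) ⟩
      p ℕ.+ count r₀          ∎)
      where open ℕP.≤-Reasoning

    C : ℕ
    C = P ℕ.* (P ℕ.+ m₁)

    count-upper : ∀ M → m₁ ≤ M → P ℕ.* count M ≤ h ℕ.* M ℕ.+ C
    count-upper M m₁≤M with q , x , refl , m₁≤x , x≤P+m₁ ← divide-by-period m₁ p M m₁≤M = begin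
      P ℕ.* count (q ℕ.* P ℕ.+ x)               ≡⟨ cong (P ℕ.*_) (count-periods q x m₁≤x) ⟩
      P ℕ.* (q ℕ.* h ℕ.+ count x)               ≡⟨ distrib P q h (count x) ⟩
      h ℕ.* (q ℕ.* P) ℕ.+ P ℕ.* count x         ≤⟨ ℕP.+-mono-≤ (ℕP.m≤m+n _ (h ℕ.* x))
                                                     (ℕP.*-monoʳ-≤ P (ℕP.≤-trans (count≤ x) x≤P+m₁)) ⟩
      h ℕ.* (q ℕ.* P) ℕ.+ h ℕ.* x ℕ.+ C         ≡⟨ cong (ℕ._+ C) (ℕP.*-distribˡ-+ h (q ℕ.* P) x) ⟨
      h ℕ.* (q ℕ.* P ℕ.+ x) ℕ.+ C               ∎
      where
      open ℕP.≤-Reasoning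
      distrib : ∀ P q h c → P ℕ.* (q ℕ.* h ℕ.+ c) ≡ h ℕ.* (q ℕ.* P) ℕ.+ P ℕ.* c
      distrib = ℕSolver.solve-∀

    count-lower : ∀ M → m₁ ≤ M → h ℕ.* M ≤ P ℕ.* count M ℕ.+ C
    count-lower M m₁≤M with q , x , refl , m₁≤x , x≤P+m₁ ← divide-by-period m₁ p M m₁≤M = begin
      h ℕ.* (q ℕ.* P ℕ.+ x)                     ≡⟨ distrib P q h x ⟩
      P ℕ.* (q ℕ.* h) ℕ.+ h ℕ.* x               ≤⟨ ℕP.+-mono-≤ (ℕP.*-monoʳ-≤ P (ℕP.m≤m+n (q ℕ.* h) (count x)))
                                                     (ℕP.*-mono-≤ (ℕP.≤-trans h≤p (ℕP.n≤1+n p)) x≤P+m₁) ⟩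
      P ℕ.* (q ℕ.* h ℕ.+ count x) ℕ.+ C         ≡⟨ cong (λ c → P ℕ.* c ℕ.+ C) (count-periods q x m₁≤x) ⟨
      P ℕ.* count (q ℕ.* P ℕ.+ x) ℕ.+ C         ∎
      where
      open ℕP.≤-Reasoning
      distrib : ∀ P q h x → h ℕ.* (q ℕ.* P ℕ.+ x) ≡ P ℕ.* (q ℕ.* h) ℕ.+ h ℕ.* x
      distrib = ℕSolver.solve-∀

    count-cross : ∀ M M' → m₁ ≤ M → m₁ ≤ M' → count M ℕ.* M' ≤ count M' ℕ.* M ℕ.+ C ℕ.* (M ℕ.+ M')
    count-cross M M' m₁≤M m₁≤M' =
      [1+p]*x≤[1+p]*y+z⇒x≤y+z p (count M ℕ.* M') (count M' ℕ.* M) (C ℕ.* (M ℕ.+ M')) (begin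
      P ℕ.* (count M ℕ.* M')                 ≡⟨ ℕP.*-assoc P (count M) M' ⟨
      P ℕ.* count M ℕ.* M'                   ≤⟨ ℕP.*-monoˡ-≤ M' (count-upper M m₁≤M) ⟩
      (h ℕ.* M ℕ.+ C) ℕ.* M'                 ≡⟨ regroup₁ h M M' C ⟩
      h ℕ.* M' ℕ.* M ℕ.+ C ℕ.* M'
        ≤⟨ ℕP.+-monoˡ-≤ (C ℕ.* M') (ℕP.*-monoˡ-≤ M (count-lower M' m₁≤M')) ⟩
      (P ℕ.* count M' ℕ.+ C) ℕ.* M ℕ.+ C ℕ.* M'  ≡⟨ regroup₂ P (count M') M M' C ⟩
      P ℕ.* (count M' ℕ.* M) ℕ.+ C ℕ.* (M ℕ.+ M') ∎)
      where
      open ℕP.≤-Reasoning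
      regroup₁ : ∀ h M M' C → (h ℕ.* M ℕ.+ C) ℕ.* M' ≡ h ℕ.* M' ℕ.* M ℕ.+ C ℕ.* M'
      regroup₁ = ℕSolver.solve-∀
      regroup₂ : ∀ P a M M' C → (P ℕ.* a ℕ.+ C) ℕ.* M ℕ.+ C ℕ.* M' ≡ P ℕ.* (a ℕ.* M) ℕ.+ C ℕ.* (M ℕ.+ M')
      regroup₂ = ℕSolver.solve-∀

    frequencyCauchy : FrequencyCauchy count
    frequencyCauchy ε 0<ε = 2 ℕ.* Z ℕ.+ m₁ , λ b b' L≤b L≤b' →
      frac-distance-< (count (suc b)) b (count (suc b')) b' (C ℕ.* (suc b ℕ.+ suc b')) ε 0<ε
        (count-cross (suc b) (suc b') (m₁≤ L≤b) (m₁≤ L≤b'))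
        (subst (λ n → count (suc b') ℕ.* suc b ≤ count (suc b) ℕ.* suc b' ℕ.+ C ℕ.* n)
          (ℕP.+-comm (suc b') (suc b)) (count-cross (suc b') (suc b) (m₁≤ L≤b') (m₁≤ L≤b)))
        (small (suc b) (suc b') (2Z< L≤b) (2Z< L≤b'))
      where
      Z : ℕ
      Z = C ℕ.* ℚ.↧ₙ ε
      m₁≤ : ∀ {b} → 2 ℕ.* Z ℕ.+ m₁ ≤ b → m₁ ≤ suc b
      m₁≤ L≤b = ℕP.≤-trans (ℕP.m≤n+m m₁ (2 ℕ.* Z)) (ℕP.m≤n⇒m≤1+n L≤b)
      2Z< : ∀ {b} → 2 ℕ.* Z ℕ.+ m₁ ≤ b → 2 ℕ.* Z < suc b
      2Z< L≤b = ℕ.s≤s (ℕP.≤-trans (ℕP.m≤m+n (2 ℕ.* Z) m₁) L≤b)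
      small : ∀ M M' → 2 ℕ.* Z < M → 2 ℕ.* Z < M' →
        C ℕ.* (M ℕ.+ M') ℕ.* ℚ.↧ₙ ε < ℤ.∣ ℚ.↥ ε ∣ ℕ.* (M ℕ.* M')
      small M M' 2Z<M 2Z<M' = subst (_< ℤ.∣ ℚ.↥ ε ∣ ℕ.* (M ℕ.* M')) (regroup C (ℚ.↧ₙ ε) M M')
        (ℕP.<-≤-trans (2*z<m⇒2*z<n⇒z*[m+n]<m*n Z M M' 2Z<M 2Z<M')
                      (ℕP.m≤n*m (M ℕ.* M') ℤ.∣ ℚ.↥ ε ∣ {{ℕ.>-nonZero (0<∣↥∣ 0<ε)}}))
        where
        regroup : ∀ C d M M' → C ℕ.* d ℕ.* (M ℕ.+ M') ≡ C ℕ.* (M ℕ.+ M') ℕ.* d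
        regroup = ℕSolver.solve-∀
        0<∣↥∣ : ∀ {ε} → 0ℚ ℚ.< ε → 0 < ℤ.∣ ℚ.↥ ε ∣
        0<∣↥∣ {ℚ.mkℚ (+ suc _) _ _} _                   = ℕ.s≤s ℕ.z≤n
        0<∣↥∣ {ℚ.mkℚ (+ 0) _ _}     (ℚ.*<* (ℤ.+<+ ()))
        0<∣↥∣ {ℚ.mkℚ -[1+ _ ] _ _}  (ℚ.*<* ())

    -- (2P - 1) / 2P bounds the frequency once the error term C is at most M / 2.
    frequencyBelow1 : FrequencyEventuallyBelow1 count
    frequencyBelow1 = frac u₀ u₀ , frac<1 {u₀} {u₀} ℕP.≤-refl , 2 ℕ.* C ℕ.+ m₁ , λ b L≤b →
      frac-≤ {count (suc b)} {b} {u₀} {u₀} (bound (suc b)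
        (ℕP.≤-trans (ℕP.m≤n+m m₁ (2 ℕ.* C)) (ℕP.m≤n⇒m≤1+n L≤b))
        (ℕP.≤-trans (ℕP.m≤m+n (2 ℕ.* C) m₁) (ℕP.m≤n⇒m≤1+n L≤b)))
      where
      u₀ : ℕ
      u₀ = p ℕ.+ P
      bound : ∀ M → m₁ ≤ M → 2 ℕ.* C ≤ M → count M ℕ.* suc u₀ ≤ u₀ ℕ.* M
      bound M m₁≤M 2C≤M = begin
        count M ℕ.* suc u₀                         ≡⟨ double p (count M) ⟩
        P ℕ.* count M ℕ.+ P ℕ.* count M            ≤⟨ ℕP.+-mono-≤ upper upper ⟩
        (p ℕ.* M ℕ.+ C) ℕ.+ (p ℕ.* M ℕ.+ C)        ≡⟨ regroup p M C ⟩
        (p ℕ.* M ℕ.+ p ℕ.* M) ℕ.+ 2 ℕ.* C          ≤⟨ ℕP.+-monoʳ-≤ (p ℕ.* M ℕ.+ p ℕ.* M) 2C≤M ⟩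
        (p ℕ.* M ℕ.+ p ℕ.* M) ℕ.+ M                ≡⟨ collect p M ⟩
        u₀ ℕ.* M                                   ∎
        where
        open ℕP.≤-Reasoning
        upper : P ℕ.* count M ≤ p ℕ.* M ℕ.+ C
        upper = ℕP.≤-trans (count-upper M m₁≤M) (ℕP.+-monoˡ-≤ C (ℕP.*-monoˡ-≤ M h≤p))
        double : ∀ p a → a ℕ.* suc (p ℕ.+ suc p) ≡ suc p ℕ.* a ℕ.+ suc p ℕ.* a
        double = ℕSolver.solve-∀
        regroup : ∀ p M C → (p ℕ.* M ℕ.+ C) ℕ.+ (p ℕ.* M ℕ.+ C) ≡ (p ℕ.* M ℕ.+ p ℕ.* M) ℕ.+ 2 ℕ.* C
        regroup = ℕSolver.solve-∀
        collect : ∀ p M → (p ℕ.* M ℕ.+ p ℕ.* M) ℕ.+ M ≡ (p ℕ.+ suc p) ℕ.* M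
        collect = ℕSolver.solve-∀

-- Eventually increasing sequences and orbits

least-of-upward-closed : ∀ {Q : ℕ → Set} → Decidable Q → (∀ {m m'} → m ≤ m' → Q m → Q m') →
  ∀ n → Q n → ∃[ M ] (∀ m → m < M → ¬ Q m) × (∀ m → M ≤ m → Q m)
least-of-upward-closed Q? upward zero    q = 0 , (λ _ ()) , λ m _ → upward ℕ.z≤n q
least-of-upward-closed Q? upward (suc n) q with Q? n
... | yes qn = least-of-upward-closed Q? upward n qn
... | no ¬qn = suc n , (λ m m<1+n qm → ¬qn (upward (ℕP.≤-pred m<1+n) qm)) , λ m 1+n≤m → upward 1+n≤m q

module Increasing (u : ℕ → ℤ) (m₀ : ℕ) (increasing : ∀ m → m₀ ≤ m → u m ℤ.< u (suc m)) where

  increasing-< : ∀ {i j} → m₀ ≤ i → i < j → u i ℤ.< u j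
  increasing-< {i} {suc j} m₀≤i (ℕ.s≤s i≤j) with ℕP.m≤n⇒m<n∨m≡n i≤j
  ... | inj₁ i<j  = ℤP.<-trans (increasing-< m₀≤i i<j) (increasing j (ℕP.≤-trans m₀≤i i≤j))
  ... | inj₂ refl = increasing i m₀≤i

  increasing-≤ : ∀ {i j} → m₀ ≤ i → i ≤ j → u i ℤ.≤ u j
  increasing-≤ m₀≤i i≤j with ℕP.m≤n⇒m<n∨m≡n i≤j
  ... | inj₁ i<j  = ℤP.<⇒≤ (increasing-< m₀≤i i<j)
  ... | inj₂ refl = ℤP.≤-refl

  growth : ∀ j → + j ℤ.+ u m₀ ℤ.≤ u (j ℕ.+ m₀)
  growth zero    = ℤP.≤-reflexive (ℤP.+-identityˡ (u m₀))
  growth (suc j) = ℤP.≤-trans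
    (ℤP.≤-reflexive (trans (cong (ℤ._+ u m₀) (ℤP.pos-+ 1 j)) (ℤP.+-assoc (+ 1) (+ j) (u m₀))))
    (ℤP.i<j⇒suc[i]≤j (ℤP.≤-<-trans (growth j) (increasing (j ℕ.+ m₀) (ℕP.m≤n+m m₀ j))))

  unbounded : ∀ X → ∃[ m ] X ℤ.< u m
  unbounded X = suc k ℕ.+ m₀ , ℤP.<-≤-trans X<1+k+u[m₀] (growth (suc k))
    where
    k : ℕ
    k = ℤ.∣ X ℤ.- u m₀ ∣
    X<1+k+u[m₀] : X ℤ.< + suc k ℤ.+ u m₀
    X<1+k+u[m₀] = ℤP.≤-<-trans
      (subst (ℤ._≤ + k ℤ.+ u m₀) (cancel X (u m₀)) (ℤP.+-monoˡ-≤ (u m₀) (≤-abs (X ℤ.- u m₀))))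
      (ℤP.+-monoˡ-< (u m₀) (ℤ.+<+ (ℕP.n<1+n k)))
      where
      cancel : ∀ x y → x ℤ.- y ℤ.+ y ≡ x
      cancel = solve-∀
      ≤-abs : ∀ i → i ℤ.≤ + ℤ.∣ i ∣
      ≤-abs (+ _)      = ℤP.≤-refl
      ≤-abs -[1+ _ ]   = ℤ.-≤+

  prefixMax : ℕ → ℤ
  prefixMax zero    = u 0
  prefixMax (suc m) = prefixMax m ℤ.⊔ u (suc m)

  ≤-prefixMax : ∀ {i m} → i ≤ m → u i ℤ.≤ prefixMax m
  ≤-prefixMax {zero}  {zero}  _ = ℤP.≤-refl
  ≤-prefixMax {i}     {suc m} i≤1+m with ℕP.m≤n⇒m<n∨m≡n i≤1+m
  ... | inj₁ i<1+m = ℤP.≤-trans (≤-prefixMax (ℕP.≤-pred i<1+m)) (ℤP.i≤i⊔j (prefixMax m) (u (suc m)))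
  ... | inj₂ refl  = ℤP.i≤j⊔i (prefixMax m) (u (suc m))

  cut : ∀ {X} → prefixMax m₀ ℤ.≤ X → ∃[ M ] (∀ m → m < M → u m ℤ.≤ X) × (∀ m → M ≤ m → X ℤ.< u m)
  cut {X} max≤X =
    let (M , below , above) = least-of-upward-closed (λ m → X ℤ.<? u m) upward _ (proj₂ (unbounded X))
    in M , (λ m m<M → ℤP.≮⇒≥ (below m m<M)) , above
    where
    upward : ∀ {m m'} → m ≤ m' → X ℤ.< u m → X ℤ.< u m'
    upward {m} m≤m' X<u[m] with m₀ ℕ.≤? m
    ... | yes m₀≤m = ℤP.<-≤-trans X<u[m] (increasing-≤ m₀≤m m≤m')
    ... | no m₀≰m  = ⊥-elim (ℤP.<⇒≱ X<u[m] (ℤP.≤-trans (≤-prefixMax (ℕP.<⇒≤ (ℕP.≰⇒> m₀≰m))) max≤X))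

length-filter-map-downFrom : ∀ {V : ℤ → Set} (V? : Decidable V) (u : ℕ → ℤ) M →
  length (filter V? (map u (downFrom M))) ≡ Counting.count (λ m → V? (u m)) M
length-filter-map-downFrom V? u zero    = refl
length-filter-map-downFrom V? u (suc M) with V? (u M)
... | yes _ = cong suc (length-filter-map-downFrom V? u M)
... | no _  = length-filter-map-downFrom V? u M

module _ {f : ℤ → ℤ} {t : ℤ} (m₀ : ℕ) (increasing : ∀ m → m₀ ≤ m → iter f m t ℤ.< iter f (suc m) t) where

  private
    orb : ℕ → ℤ
    orb m = iter f m t

  open Increasing orb m₀ increasing

  increasing-orbit-≢ : ∀ {i j} → i < j → orb i ≢ orb j
  increasing-orbit-≢ {i} {j} i<j orb[i]≡orb[j] = ℤP.<-irrefl
    (trans (iter-+ f m₀ i t) (trans (cong (iter f m₀) orb[i]≡orb[j]) (sym (iter-+ f m₀ j t))))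
    (increasing-< (ℕP.m≤m+n m₀ i) (ℕP.+-monoʳ-< m₀ i<j))

  increasing-orbit-injective : ∀ {i j} → orb i ≡ orb j → i ≡ j
  increasing-orbit-injective {i} {j} orb[i]≡orb[j] with ℕP.<-cmp i j
  ... | tri< i<j _ _ = ⊥-elim (increasing-orbit-≢ i<j orb[i]≡orb[j])
  ... | tri≈ _ i≡j _ = i≡j
  ... | tri> _ _ j<i = ⊥-elim (increasing-orbit-≢ j<i (sym orb[i]≡orb[j]))

  countBelow-increasing-orbit : ∀ {X M} → (∀ m → m < M → orb m ℤ.≤ X) → (∀ m → M ≤ m → X ℤ.< orb m) →
    CountBelow (Orb f t) X M
  countBelow-increasing-orbit {X} {M} below above =
    map orb (downFrom M) , map⁺ increasing-orbit-injective (downFrom⁺ M) ,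
    trans (length-map orb (downFrom M)) (length-downFrom M) , λ x → mk⇔ listed⇒below below⇒listed
    where
    listed⇒below : ∀ {x} → x ∈ map orb (downFrom M) → Orb f t x × x ℤ.≤ X
    listed⇒below x∈ with m , m∈ , refl ← ∈-map⁻ orb x∈ = (m , refl) , below m (∈-downFrom⁻ m∈)
    below⇒listed : ∀ {x} → Orb f t x × x ℤ.≤ X → x ∈ map orb (downFrom M)
    below⇒listed ((m , refl) , orb[m]≤X) with m ℕ.<? M
    ... | yes m<M = ∈-map⁺ orb (∈-downFrom⁺ m<M)
    ... | no m≮M  = ⊥-elim (ℤP.<⇒≱ (above m (ℕP.≮⇒≥ m≮M)) orb[m]≤X)

  countsAt-increasing-orbit : ∀ {U : ℤ → Set} (U? : Decidable U) L → ∃[ X₁ ] ∀ X → X₁ ℤ.≤ X →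
    ∃[ b ] L ≤ b × CountsAt f t U X (Counting.count (λ m → U? (iter f m t)) (suc b)) b
  countsAt-increasing-orbit U? L = prefixMax m₀ ℤ.⊔ orb L , λ X X₁≤X →
    let (M , below , above) = cut (ℤP.≤-trans (ℤP.i≤i⊔j (prefixMax m₀) (orb L)) X₁≤X)
        orb[L]≤X = ℤP.≤-trans (ℤP.i≤j⊔i (prefixMax m₀) (orb L)) X₁≤X
    in counts M below above (ℕP.≰⇒> λ M≤L → ℤP.<⇒≱ (above L M≤L) orb[L]≤X)
    where
    counts : ∀ {X} M → (∀ m → m < M → orb m ℤ.≤ X) → (∀ m → M ≤ m → X ℤ.< orb m) → L < M →
      ∃[ b ] L ≤ b × CountsAt f t _ X (Counting.count (λ m → U? (iter f m t)) (suc b)) b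
    counts (suc b) below above (ℕ.s≤s L≤b) =
      b , L≤b , subst (CountBelow _ _) (length-filter-map-downFrom U? (λ m → iter f m t) (suc b)) cU , cO
      where
      cO = countBelow-increasing-orbit below above
      cU = countBelow-filter U? cO

-- Polynomials

horner-step-positive : ∀ c x e → + suc ℤ.∣ c ∣ ℤ.≤ x → + 0 ℤ.< e → + 0 ℤ.< c ℤ.+ x ℤ.* e
horner-step-positive (+ _)      +[1+ _ ] +[1+ _ ] _                  _ =
  ℤ.+<+ (ℕP.<-≤-trans (ℕ.s≤s ℕ.z≤n) (ℕP.m≤n+m _ _))
horner-step-positive -[1+ c ]   +[1+ x ] +[1+ e ] (ℤ.+≤+ (ℕ.s≤s c≤x)) _ =
  subst (+ 0 ℤ.<_) (sym (ℤP.⊖-≥ (ℕP.<⇒≤ c<x*e))) (ℤ.+<+ (ℕP.m<n⇒0<n∸m c<x*e))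
  where c<x*e = ℕP.≤-trans (ℕ.s≤s c≤x) (ℕP.m≤m*n (suc x) (suc e))
horner-step-positive c          (+ 0)    e        (ℤ.+≤+ ())         _
horner-step-positive c          x        (+ 0)    _                  (ℤ.+<+ ())
horner-step-positive c          -[1+ _ ] e        ()                 _

horner-step-negative : ∀ c x e → + suc ℤ.∣ c ∣ ℤ.≤ x → e ℤ.< + 0 → c ℤ.+ x ℤ.* e ℤ.< + 0
horner-step-negative c x e x-large e<0 = subst (ℤ._< + 0) (ℤP.neg-involutive _) (ℤP.neg-mono-<
  (subst (+ 0 ℤ.<_) (negate c x e)
    (horner-step-positive (ℤ.- c) x (ℤ.- e)
      (subst (λ a → + suc a ℤ.≤ x) (sym (ℤP.∣-i∣≡∣i∣ c)) x-large) (ℤP.neg-mono-< e<0))))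
  where
  negate : ∀ c x e → ℤ.- c ℤ.+ x ℤ.* ℤ.- e ≡ ℤ.- (c ℤ.+ x ℤ.* e)
  negate = solve-∀

eval-eventually-signed : ∀ {d} (cs : Vec ℤ (suc d)) → ∃[ B ] ∀ x → + B ℤ.≤ x →
  (+ 0 ℤ.< leading cs → + 0 ℤ.< eval cs x) × (leading cs ℤ.< + 0 → eval cs x ℤ.< + 0)
eval-eventually-signed (c ∷ []) = 0 , λ x _ →
  subst (+ 0 ℤ.<_) (sym (constant x)) , subst (ℤ._< + 0) (sym (constant x))
  where
  constant : ∀ x → c ℤ.+ x ℤ.* + 0 ≡ c
  constant x = trans (cong (λ y → c ℤ.+ y) (ℤP.*-zeroʳ x)) (ℤP.+-identityʳ c)
eval-eventually-signed (c ∷ c' ∷ cs) with B , signed ← eval-eventually-signed (c' ∷ cs) =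
  B ℕ.+ suc ℤ.∣ c ∣ , λ x B+1+∣c∣≤x →
    let B≤x      = ℤP.≤-trans (ℤ.+≤+ (ℕP.m≤m+n B (suc ℤ.∣ c ∣))) B+1+∣c∣≤x
        1+∣c∣≤x  = ℤP.≤-trans (ℤ.+≤+ (ℕP.m≤n+m (suc ℤ.∣ c ∣) B)) B+1+∣c∣≤x
        (pos , neg) = signed x B≤x
    in (λ lead>0 → horner-step-positive c x _ 1+∣c∣≤x (pos lead>0)) ,
       (λ lead<0 → horner-step-negative c x _ 1+∣c∣≤x (neg lead<0))

minus-diagonal : ∀ {d} → Vec ℤ (suc (suc d)) → Vec ℤ (suc (suc d))
minus-diagonal (c₀ ∷ c₁ ∷ cs) = c₀ ∷ c₁ ℤ.- + 1 ∷ cs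

eval-minus-diagonal : ∀ {d} (cs : Vec ℤ (suc (suc d))) x → eval (minus-diagonal cs) x ≡ eval cs x ℤ.- x
eval-minus-diagonal (c₀ ∷ c₁ ∷ cs) x = expand c₀ c₁ x (eval cs x)
  where
  expand : ∀ c₀ c₁ x r → c₀ ℤ.+ x ℤ.* ((c₁ ℤ.- + 1) ℤ.+ x ℤ.* r) ≡ (c₀ ℤ.+ x ℤ.* (c₁ ℤ.+ x ℤ.* r)) ℤ.- x
  expand = solve-∀

-- This is where degree ≥ 2 is needed: in degree 1 the leading coefficient would drop by 1.
leading-minus-diagonal : ∀ {d} (cs : Vec ℤ (suc (suc (suc d)))) → leading (minus-diagonal cs) ≡ leading cs
leading-minus-diagonal (c₀ ∷ c₁ ∷ c₂ ∷ cs) = refl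

eval-eventually-expanding-or-contracting : ∀ {d} (cs : Vec ℤ (suc (suc (suc d)))) → leading cs ≢ + 0 →
  ∃[ B ] ((∀ x → B ℤ.≤ x → x ℤ.< eval cs x) ⊎ (∀ x → B ℤ.≤ x → eval cs x ℤ.< x))
eval-eventually-expanding-or-contracting cs lead≢0
  with eval-eventually-signed (minus-diagonal cs) | ℤP.<-cmp (leading cs) (+ 0)
... | B , signed | tri< lead<0 _ _ = + B , inj₂ λ x B≤x →
  difference-<0 (subst (ℤ._< + 0) (eval-minus-diagonal cs x)
    (proj₂ (signed x B≤x) (subst (ℤ._< + 0) (sym (leading-minus-diagonal cs)) lead<0)))
  where
  difference-<0 : ∀ {x y} → y ℤ.- x ℤ.< + 0 → y ℤ.< x
  difference-<0 {x} {y} y-x<0 = subst₂ ℤ._<_ (cancel y x) (ℤP.+-identityˡ x) (ℤP.+-monoˡ-< x y-x<0)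
    where
    cancel : ∀ y x → y ℤ.- x ℤ.+ x ≡ y
    cancel = solve-∀
... | _ | tri≈ _ lead≡0 _ = ⊥-elim (lead≢0 lead≡0)
... | B , signed | tri> _ _ lead>0 = + B , inj₁ λ x B≤x →
  difference->0 (subst (+ 0 ℤ.<_) (eval-minus-diagonal cs x)
    (proj₁ (signed x B≤x) (subst (+ 0 ℤ.<_) (sym (leading-minus-diagonal cs)) lead>0)))
  where
  difference->0 : ∀ {x y} → + 0 ℤ.< y ℤ.- x → x ℤ.< y
  difference->0 {x} {y} y-x>0 = subst₂ ℤ._<_ (ℤP.+-identityˡ x) (cancel y x) (ℤP.+-monoˡ-< x y-x>0)
    where
    cancel : ∀ y x → y ℤ.- x ℤ.+ x ≡ y
    cancel = solve-∀

-- Unions of classes of t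

module UnionOfClasses {f : ℤ → ℤ} (pres : PreservesCongruences f) (t : ℤ)
                      {k : ℕ} (n : Fin k → ℕ) (n>0 : ∀ s → 0 < n s)
                      (f[t]∉ : ∀ s → ¬ AP t (n s) (f t)) where

  InUnion : ℤ → Set
  InUnion x = ∃[ s ] AP t (n s) x

  inUnion? : Decidable InUnion
  inUnion? x = any? (λ s → n s ∣? ℤ.∣ x ℤ.- t ∣)

  N : ℕ
  N = product (tabulate n)

  instance
    N≢0 : ℕ.NonZero N
    N≢0 = ℕ.>-nonZero (product-pos k n n>0)
      where
      product-pos : ∀ k (n : Fin k → ℕ) → (∀ s → 0 < n s) → 0 < product (tabulate n)
      product-pos zero    n n>0 = ℕ.s≤s ℕ.z≤n
      product-pos (suc k) n n>0 = ℕP.*-mono-≤ (n>0 fzero) (product-pos k (n ∘ fsuc) (n>0 ∘ fsuc))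

  inUnion-resp : ∀ {x y} → x ≡ y mod N → InUnion x → InUnion y
  inUnion-resp x≡y (s , x∈s) =
    s , ≡mod⇒AP (≡mod-trans (≡mod-sym (≡mod-weaken (∈⇒∣product (∈-tabulate⁺ s)) x≡y)) (AP⇒≡mod x∈s))

  densityLt1-of-increasing-orbit : OrbitEventuallyIncreasing f t → DensityLt1 f t InUnion
  densityLt1-of-increasing-orbit (m₀ , increasing) =
    densityLt1-of-frequency count frequencyCauchy frequencyBelow1
      (countsAt-increasing-orbit m₀ increasing inUnion?)
    where
    B : ℕ → Set
    B m = InUnion (iter f m t)
    open Counting {B} (λ m → inUnion? (iter f m t))
    residues-periodic = orbit-eventually-periodic-mod f t pres N
    m₁ = proj₁ residues-periodic
    p = proj₁ (proj₂ residues-periodic)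
    periodic-mod : ∀ x → m₁ ≤ x → iter f (suc p ℕ.+ x) t ≡ iter f x t mod N
    periodic-mod = proj₂ (proj₂ residues-periodic)
    periodic : ∀ x → m₁ ≤ x → B (suc p ℕ.+ x) ⇔ B x
    periodic x m₁≤x =
      mk⇔ (inUnion-resp (periodic-mod x m₁≤x)) (inUnion-resp (≡mod-sym (periodic-mod x m₁≤x)))
    gap : ¬ B (suc (m₁ ℕ.* suc p))
    gap (s , ∈s) = orbit-outside-class f t pres (∈⇒∣product (∈-tabulate⁺ s)) periodic-mod
                     (f[t]∉ s ∘ ≡mod⇒AP) (AP⇒≡mod ∈s)
    open Periodic m₁ p periodic (suc (m₁ ℕ.* suc p)) (ℕP.m≤n⇒m≤1+n (ℕP.m≤m*n m₁ (suc p))) gap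

unionOfClasses-densityLt1 : ∀ {d} (cs : Vec ℤ (suc (suc (suc d)))) → leading cs ≢ + 0 → ∀ t {k} →
  (n : Fin (suc k) → ℕ) → (∀ s → 0 < n s) → (∀ s → DensityLt1 (eval cs) t (AP t (n s))) →
  DensityLt1 (eval cs) t (λ x → ∃[ s ] AP t (n s) x)
unionOfClasses-densityLt1 cs lead≢0 t n n>0 dense =
  by-dichotomy (eval-eventually-expanding-or-contracting cs lead≢0)
  where
  f = eval cs
  pres = eval-preservesCongruences cs
  f[t]∉ : ∀ s → ¬ AP t (n s) (f t)
  f[t]∉ s f[t]∈s =
    full⇒¬densityLt1 (λ where (m , refl) → ≡mod⇒AP (orbit-in-class pres (AP⇒≡mod f[t]∈s) m)) (dense s)
  open UnionOfClasses pres t n n>0 f[t]∉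
  X₀ = proj₁ (proj₁ (proj₁ (dense fzero)))
  orbit-count : ∀ X → X₀ ℤ.≤ X → ∃[ b ] CountBelow (Orb f t) X (suc b)
  orbit-count X X₀≤X =
    let (_ , _ , b , _ , cO , _) = proj₂ (proj₁ (proj₁ (dense fzero))) X X₀≤X in b , cO
  count-above : ∀ B → ∃[ b ] CountBelow (Orb f t) (X₀ ℤ.⊔ B) (suc b)
  count-above B = orbit-count (X₀ ℤ.⊔ B) (ℤP.i≤i⊔j X₀ B)
  bounded⇒densityLt1 : OrbitBoundedAbove f t → DensityLt1 f t InUnion
  bounded⇒densityLt1 (Z , bounded) =
    densityLt1-of-bounded-orbit inUnion? (λ m → ℤP.≤-trans (bounded m) (ℤP.i≤j⊔i X₀ Z))
      (proj₂ (count-above Z)) (1 , refl) λ (s , f[t]∈s) → f[t]∉ s f[t]∈s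
  by-dichotomy : ∃[ B ] ((∀ x → B ℤ.≤ x → x ℤ.< f x) ⊎ (∀ x → B ℤ.≤ x → f x ℤ.< x)) →
    DensityLt1 f t InUnion
  by-dichotomy (B , inj₂ contracting) =
    bounded⇒densityLt1 (contracting-orbit-bounded f t contracting (ℤP.i≤j⊔i X₀ B) (proj₂ (count-above B)))
  by-dichotomy (B , inj₁ expanding)
    with expanding-orbit-bounded-or-increasing f t expanding (ℤP.i≤j⊔i X₀ B) (proj₂ (count-above B))
  ... | inj₁ bounded    = bounded⇒densityLt1 bounded
  ... | inj₂ increasing = densityLt1-of-increasing-orbit increasing

corollary5p3 : (d : ℕ) → 2 ≤ d → (c : Vec ℤ (suc d)) → leading c ≢ + 0 → (t : ℤ) →
    ((k : ℕ) → (n : Fin k → ℕ) → (∀ s → 0 < n s) →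
       IsMinimalCover (eval c) t k (λ _ → t) n →
       IsTCover (eval c) t k (λ _ → t) n →
       k ≡ 1)
    ×
    ((k : ℕ) → 1 ≤ k → (n : Fin k → ℕ) → (∀ s → 0 < n s) →
       (∀ s → DensityLt1 (eval c) t (AP t (n s))) →
       DensityLt1 (eval c) t (λ x → ∃[ s ] AP t (n s) x))
corollary5p3 (suc (suc d)) _ c lead≢0 t =
  (λ k n _ minimal _ → minimalCover-of-classes-of-t⇒k≡1 (eval-preservesCongruences c) t k n minimal) ,
  λ where (suc k) _ n n>0 dense → unionOfClasses-densityLt1 c lead≢0 t n n>0 dense
corollary5p3 (suc zero) (ℕ.s≤s ())
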